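{- Let $\sigma$ and $\sigma'$ be two V-faces contained in a simplicial facet $\tau$ of a Newton polyhedron $\Gamma\subset\mathbb{R}^n$, with $\sigma\cap\sigma'\neq\emptyset$. Then $\sigma\cap\sigma'$ and $\sigma+\sigma'$ are also V-faces.
   Context: A Newton polyhedron in $\mathbb{R}^n$ is the convex hull of $\bigcup_{\underline{k}\in S}(\underline{k}+\mathbb{R}^n_{\ge0})$ for a non-empty finite set $S\subset\mathbb{Z}^n_{\ge0}$. A simplicial facet is a compact face of dimension $n-1$ which is a simplex. For $I\subset\{1,\dots,n\}$ let $L_I=\{x\in\mathbb{R}^n: x_i=0\ \forall i\notin I\}$. A compact face $\sigma$ of $\Gamma$ is a V-face if $\sigma\subset L_I$ for some $I$ with $\#I=\dim\sigma+1$. For faces $\sigma,\sigma'$ of the simplex $\tau$, $\sigma+\sigma'$ denotes the smallest face of $\tau$ containing both $\sigma$ and $\sigma'$.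
   Formalization: The Newton polyhedron Γ and all its faces lie in ℚ^n instead of ℝ^n, with faces cut out by hyperplanes having rational normal vectors. -}

module Defs where

open import Data.Nat using (ℕ; zero; suc)
open import Data.Fin using (Fin; zero; suc)
open import Data.Fin.Subset using (Subset; _∉_) renaming (∣_∣ to card)
open import Data.Integer using (+_)
open import Data.Rational using (ℚ; 0ℚ; 1ℚ; _+_; _*_; _≤_; _/_; ∣_∣)
open import Data.List using (List)
open import Data.List.Membership.Propositional using (_∈_)
open import Data.Product using (Σ; ∃; ∃-syntax; _×_; _,_)
open import Relation.Binary.PropositionalEquality using (_≡_)
open import Relation.Nullary using (¬_)

-- points of ℚ^n (the polyhedra are rational)
Pt : ℕ → Set
Pt n = Fin n → ℚ

Region : ℕ → Set₁
Region n = Pt n → Set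

ℕ→ℚ : ℕ → ℚ
ℕ→ℚ k = + k / 1

sumFin : ∀ {r} → (Fin r → ℚ) → ℚ
sumFin {zero} f = 0ℚ
sumFin {suc r} f = f zero + sumFin (λ j → f (suc j))

dot : ∀ {n} → Pt n → Pt n → ℚ
dot w x = sumFin (λ i → w i * x i)

InConv : ∀ {n r} → (Fin r → Pt n) → Pt n → Set
InConv {n} {r} p x =
  Σ (Fin r → ℚ) λ μ → (∀ j → 0ℚ ≤ μ j) × (sumFin μ ≡ 1ℚ)
    × (∀ i → x i ≡ sumFin (λ j → μ j * p j i))

ConvexHull : ∀ {n} → Region n → Region n
ConvexHull {n} A x = ∃[ r ] Σ (Fin r → Pt n) λ p → (∀ j → A (p j)) × InConv p x

ShiftedOrthants : ∀ {n} → List (Fin n → ℕ) → Region n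
ShiftedOrthants S y = ∃[ k ] (k ∈ S) × (∀ i → ℕ→ℚ (k i) ≤ y i)

Newton : ∀ {n} → List (Fin n → ℕ) → Region n
Newton S = ConvexHull (ShiftedOrthants S)

SameSet : ∀ {n} → Region n → Region n → Set
SameSet A B = ∀ x → (A x → B x) × (B x → A x)

Sub : ∀ {n} → Region n → Region n → Set
Sub A B = ∀ x → A x → B x

_∩_ : ∀ {n} → Region n → Region n → Region n
(A ∩ B) x = A x × B x

Nonempty : ∀ {n} → Region n → Set
Nonempty A = ∃[ x ] A x

Bounded : ∀ {n} → Region n → Set
Bounded A = ∃[ B ] (∀ x → A x → ∀ i → ∣ x i ∣ ≤ B)

-- F is a face of the convex set P: the intersection of P with a supporting hyperplane
-- (w = 0, c ≤ everything gives P itself; the empty face is allowed)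
FaceOf : ∀ {n} → Region n → Region n → Set
FaceOf {n} P F = Σ (Pt n) λ w → Σ ℚ λ c →
  (∀ x → P x → c ≤ dot w x) × SameSet F (λ x → P x × dot w x ≡ c)

CompactFace : ∀ {n} → Region n → Region n → Set
CompactFace P F = FaceOf P F × Nonempty F × Bounded F

AffInd : ∀ {n m} → (Fin m → Pt n) → Set
AffInd {n} {m} p = (a : Fin m → ℚ) → sumFin a ≡ 0ℚ →
  (∀ i → sumFin (λ j → a j * p j i) ≡ 0ℚ) → ∀ j → a j ≡ 0ℚ

HasDim : ∀ {n} → Region n → ℕ → Set
HasDim {n} F d =
  (Σ (Fin (suc d) → Pt n) λ p → (∀ j → F (p j)) × AffInd p)
  × ((p : Fin (suc (suc d)) → Pt n) → (∀ j → F (p j)) → ¬ AffInd p)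

IsSimplex : ∀ {n} → Region n → Set
IsSimplex {n} F = ∃[ d ] Σ (Fin (suc d) → Pt n) λ v → AffInd v × SameSet F (InConv v)

SimplicialFacet : ∀ {n} → Region n → Region n → Set
SimplicialFacet {n} P τ =
  CompactFace P τ × (∃[ d ] (suc d ≡ n) × HasDim τ d) × IsSimplex τ

VFace : ∀ {n} → Region n → Region n → Set
VFace {n} P σ = CompactFace P σ × ∃[ d ] HasDim σ d ×
  (Σ (Subset n) λ I → (card I ≡ suc d) × (∀ x → σ x → ∀ i → i ∉ I → x i ≡ 0ℚ))

-- G = σ + σ': the smallest face of τ containing σ and σ'
SmallestFaceContaining : ∀ {n} → Region n → Region n → Region n → Region n → Set₁
SmallestFaceContaining {n} τ σ σ' G = FaceOf τ G × Sub σ G × Sub σ' G ×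
  ((H : Region n) → FaceOf τ H → Sub σ H → Sub σ' H → Sub G H)

{-# OPTIONS --safe #-}
module Submission where

-- The supporting hyperplane w·x = c of a compact face τ of a Newton polyhedron has every w i ≠ 0,
-- because the polyhedron is closed under x ↦ x + t eᵢ (t ≥ 0).  Hence for nonempty J the section
-- τ ∩ L_J lies in an affine space of dimension #J − 1, and any #J affinely independent points of it
-- span it.  A V-face σ ⊂ L_I of τ, of dimension #I − 1, is therefore the whole section τ ∩ L_I; as τ is
-- a simplex whose points have nonnegative coordinates, this section is spanned by the set V_I of
-- vertices of τ lying in L_I, and #V_I = #I.  For two V-faces,
--   #(V_I ∪ V_I′) + #(V_I ∩ V_I′) = #V_I + #V_I′ = #I + #I′ = #(I ∪ I′) + #(I ∩ I′),
-- while #(V_I ∪ V_I′) ≤ #(I ∪ I′) and #(V_I ∩ V_I′) ≤ #(I ∩ I′); so both are equalities, which exhibits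
-- σ ∩ σ′ = τ ∩ L_{I∩I′} and σ + σ′ = τ ∩ L_{I∪I′} as V-faces.

open import Defs
open import Data.Nat as ℕ using (ℕ; zero; suc; s≤s; z≤n)
import Data.Nat.Properties as ℕ
open import Data.Fin as Fin using (Fin; zero; suc; punchIn)
open import Data.Fin.Properties using (any?; all?; punchInᵢ≢i)
open import Data.Fin.Subset using (Subset; _∈_; _∉_; _-_; inside; outside)
  renaming (∣_∣ to card; _∪_ to _∪ₛ_; _∩_ to _∩ₛ_; Nonempty to Nonemptyₛ)
open import Data.Fin.Subset.Properties
  using (_∈?_; drop-there; x∈p∪q⁺; x∈p∪q⁻; x∈p∩q⁺; x∈p∩q⁻; x∈p∧x≢y⇒x∈p-y; x∈p⇒∣p-x∣<∣p∣;
         nonempty?; Empty-unique; ∣⊥∣≡0)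
open import Data.Vec using ([]; _∷_; here; there)
open import Data.Vec.Functional as Vector using (insertAt)
open import Data.Vec.Functional.Properties using (insertAt-lookup; insertAt-punchIn)
open import Data.List using (List; [])
open import Data.Rational as ℚ
  using (ℚ; 0ℚ; 1ℚ; _+_; _*_; -_; _≤_; _<_; 1/_; ≢-nonZero; ∣_∣)
open import Data.Rational.Properties
open import Data.Rational.Solver using (module +-*-Solver)
open import Data.Product using (Σ; ∃; ∃-syntax; _×_; _,_; proj₁; proj₂)
open import Data.Sum using (inj₁; inj₂)
open import Data.Empty using (⊥-elim)
open import Function using (_∘_)
open import Relation.Nullary using (¬_; Dec; yes; no; does)
open import Relation.Nullary.Decidable using (_→-dec_; ¬?; decidable-stable)
open import Relation.Binary.PropositionalEquality
open import Algebra.Bundles using (Ring)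
open import Algebra.Properties.Semiring.Sum (Ring.semiring +-*-ring)
  using (sum; sum-cong-≗; sum-replicate-zero; ∑-distrib-+; ∑-comm; sum-remove; *-distribˡ-sum; *-distribʳ-sum)

open +-*-Solver

-- Finite sums over ℚ

sumFin≡sum : ∀ {r} (f : Fin r → ℚ) → sumFin f ≡ sum f
sumFin≡sum {zero} f = refl
sumFin≡sum {suc r} f = cong (f zero +_) (sumFin≡sum (f ∘ suc))

module _ {r : ℕ} where

  sumFin-cong : {f g : Fin r → ℚ} → f ≗ g → sumFin f ≡ sumFin g
  sumFin-cong {f} {g} f≗g = trans (sumFin≡sum f) (trans (sum-cong-≗ {x = f} {y = g} f≗g) (sym (sumFin≡sum g)))

  sumFin-zero : {f : Fin r → ℚ} → (∀ j → f j ≡ 0ℚ) → sumFin f ≡ 0ℚ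
  sumFin-zero f≗0 = trans (sumFin-cong f≗0) (trans (sumFin≡sum {r} (λ _ → 0ℚ)) (sum-replicate-zero r))

  sumFin-+ : (f g : Fin r → ℚ) → sumFin (λ j → f j + g j) ≡ sumFin f + sumFin g
  sumFin-+ f g = trans (sumFin≡sum (λ j → f j + g j))
    (trans (∑-distrib-+ f g) (sym (cong₂ _+_ (sumFin≡sum f) (sumFin≡sum g))))

  sumFin-*ˡ : (c : ℚ) (f : Fin r → ℚ) → sumFin (λ j → c * f j) ≡ c * sumFin f
  sumFin-*ˡ c f = trans (sumFin≡sum (λ j → c * f j))
    (sym (trans (cong (c *_) (sumFin≡sum f)) (*-distribˡ-sum c f)))

  sumFin-*ʳ : (c : ℚ) (f : Fin r → ℚ) → sumFin (λ j → f j * c) ≡ sumFin f * c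
  sumFin-*ʳ c f = trans (sumFin≡sum (λ j → f j * c))
    (sym (trans (cong (_* c) (sumFin≡sum f)) (*-distribʳ-sum c f)))

sumFin-comm : ∀ {r s} (f : Fin r → Fin s → ℚ) →
  sumFin (λ i → sumFin (f i)) ≡ sumFin (λ j → sumFin (λ i → f i j))
sumFin-comm f = begin
  sumFin (λ i → sumFin (f i))             ≡⟨ sumFin-cong (λ i → sumFin≡sum (f i)) ⟩
  sumFin (λ i → sum (f i))                ≡⟨ sumFin≡sum (λ i → sum (f i)) ⟩
  sum (λ i → sum (f i))                   ≡⟨ ∑-comm f ⟩
  sum (λ j → sum (λ i → f i j))           ≡⟨ sumFin≡sum (λ j → sum (λ i → f i j)) ⟨
  sumFin (λ j → sum (λ i → f i j))        ≡⟨ sumFin-cong (λ j → sumFin≡sum (λ i → f i j)) ⟨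
  sumFin (λ j → sumFin (λ i → f i j))     ∎
  where open ≡-Reasoning

sumFin-remove : ∀ {r} (f : Fin (suc r) → ℚ) (k : Fin (suc r)) →
  sumFin f ≡ f k + sumFin (f ∘ punchIn k)
sumFin-remove f k = trans (sumFin≡sum f)
  (trans (sum-remove {i = k} f) (cong (f k +_) (sym (sumFin≡sum (f ∘ punchIn k)))))

sumFin-single : ∀ {r} (f : Fin r → ℚ) (k : Fin r) → (∀ j → j ≢ k → f j ≡ 0ℚ) → sumFin f ≡ f k
sumFin-single {suc r} f k vanish = begin
  sumFin f                       ≡⟨ sumFin-remove f k ⟩
  f k + sumFin (f ∘ punchIn k)   ≡⟨ cong (f k +_) (sumFin-zero (λ j → vanish _ (punchInᵢ≢i k j))) ⟩
  f k + 0ℚ                       ≡⟨ +-identityʳ (f k) ⟩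
  f k                            ∎
  where open ≡-Reasoning

sumFin-nonneg : ∀ {r} (f : Fin r → ℚ) → (∀ j → 0ℚ ≤ f j) → 0ℚ ≤ sumFin f
sumFin-nonneg {zero} f _ = ≤-refl
sumFin-nonneg {suc r} f f≥0 = +-mono-≤ (f≥0 zero) (sumFin-nonneg (f ∘ suc) (f≥0 ∘ suc))

nonneg+nonneg≡0⇒≡0 : ∀ {a b} → 0ℚ ≤ a → 0ℚ ≤ b → a + b ≡ 0ℚ → a ≡ 0ℚ
nonneg+nonneg≡0⇒≡0 {a} {b} a≥0 b≥0 a+b≡0 = ≤-antisym (begin
  a       ≡⟨ +-identityʳ a ⟨
  a + 0ℚ  ≤⟨ +-monoʳ-≤ a b≥0 ⟩
  a + b   ≡⟨ a+b≡0 ⟩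
  0ℚ      ∎) a≥0
  where open ≤-Reasoning

sumFin-nonneg≡0 : ∀ {r} (f : Fin r → ℚ) → (∀ j → 0ℚ ≤ f j) → sumFin f ≡ 0ℚ → ∀ j → f j ≡ 0ℚ
sumFin-nonneg≡0 {suc r} f f≥0 Σ≡0 zero = nonneg+nonneg≡0⇒≡0 (f≥0 zero) (sumFin-nonneg _ (f≥0 ∘ suc)) Σ≡0
sumFin-nonneg≡0 {suc r} f f≥0 Σ≡0 (suc j) = sumFin-nonneg≡0 (f ∘ suc) (f≥0 ∘ suc)
  (nonneg+nonneg≡0⇒≡0 (sumFin-nonneg _ (f≥0 ∘ suc)) (f≥0 zero) (trans (+-comm _ (f zero)) Σ≡0)) j

δ : ∀ {r} → Fin r → Fin r → ℚ
δ i j with i Fin.≟ j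
... | yes _ = 1ℚ
... | no  _ = 0ℚ

δ-diag : ∀ {r} (i : Fin r) → δ i i ≡ 1ℚ
δ-diag i with i Fin.≟ i
... | yes _  = refl
... | no i≢i = ⊥-elim (i≢i refl)

δ-off : ∀ {r} {i j : Fin r} → j ≢ i → δ i j ≡ 0ℚ
δ-off {i = i} {j} j≢i with i Fin.≟ j
... | yes i≡j = ⊥-elim (j≢i (sym i≡j))
... | no  _   = refl

δ-nonneg : ∀ {r} (i j : Fin r) → 0ℚ ≤ δ i j
δ-nonneg i j with i Fin.≟ j
... | yes _ = nonNegative⁻¹ 1ℚ
... | no  _ = ≤-refl

sumFin-δ* : ∀ {r} (k : Fin r) (f : Fin r → ℚ) → sumFin (λ j → δ k j * f j) ≡ f k
sumFin-δ* k f = trans (sumFin-single _ k (λ j j≢k → trans (cong (_* f j) (δ-off j≢k)) (*-zeroˡ (f j))))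
  (trans (cong (_* f k) (δ-diag k)) (*-identityˡ (f k)))

sumFin-δ : ∀ {r} (k : Fin r) → sumFin (δ k) ≡ 1ℚ
sumFin-δ k = trans (sumFin-cong (λ j → sym (*-identityʳ (δ k j)))) (sumFin-δ* k (λ _ → 1ℚ))

*-nonneg : ∀ {a b} → 0ℚ ≤ a → 0ℚ ≤ b → 0ℚ ≤ a * b
*-nonneg {a} {b} a≥0 b≥0 =
  nonNegative⁻¹ (a * b) {{nonNeg*nonNeg⇒nonNeg a {{ℚ.nonNegative a≥0}} b {{ℚ.nonNegative b≥0}}}}

ℕ→ℚ-nonneg : ∀ k → 0ℚ ≤ ℕ→ℚ k
ℕ→ℚ-nonneg k = nonNegative⁻¹ (ℕ→ℚ k) {{normalize-nonNeg k 1}}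

inverse : (a : ℚ) → a ≢ 0ℚ → ℚ
inverse a a≢0 = (1/ a) {{≢-nonZero a≢0}}

inverse-*ˡ : ∀ a (a≢0 : a ≢ 0ℚ) → inverse a a≢0 * a ≡ 1ℚ
inverse-*ˡ a a≢0 = *-inverseˡ a {{≢-nonZero a≢0}}

*-cancelˡ-≡0 : ∀ {a b} → a ≢ 0ℚ → a * b ≡ 0ℚ → b ≡ 0ℚ
*-cancelˡ-≡0 {a} {b} a≢0 ab≡0 = begin
  b                          ≡⟨ *-identityˡ b ⟨
  1ℚ * b                     ≡⟨ cong (_* b) (inverse-*ˡ a a≢0) ⟨
  inverse a a≢0 * a * b      ≡⟨ *-assoc (inverse a a≢0) a b ⟩
  inverse a a≢0 * (a * b)    ≡⟨ cong (inverse a a≢0 *_) ab≡0 ⟩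
  inverse a a≢0 * 0ℚ         ≡⟨ *-zeroʳ (inverse a a≢0) ⟩
  0ℚ                         ∎
  where open ≡-Reasoning

-- Linear and affine dependence

combination : ∀ {m n} → (Fin m → ℚ) → (Fin m → Pt n) → Pt n
combination a p i = sumFin (λ j → a j * p j i)

Nontrivial : ∀ {m} → (Fin m → ℚ) → Set
Nontrivial a = ∃[ j ] a j ≢ 0ℚ

LinDep : ∀ {m n} → (Fin m → Pt n) → Set
LinDep {m} u = Σ (Fin m → ℚ) λ a → (∀ i → combination a u i ≡ 0ℚ) × Nontrivial a

L : ∀ {n} → Subset n → Region n
L J x = ∀ i → i ∉ J → x i ≡ 0ℚ

L-tail : ∀ {n b} {J : Subset n} {x : Pt (suc n)} → L (b ∷ J) x → L J (Vector.tail x)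
L-tail x∈L i i∉J = x∈L (suc i) (i∉J ∘ drop-there)

linDep-tail : ∀ {m n} (u : Fin m → Pt (suc n)) → (∀ j → u j zero ≡ 0ℚ) →
  LinDep (Vector.tail ∘ u) → LinDep u
linDep-tail u head≡0 (a , a·u≡0 , a≢0) = a , a·u≡0′ , a≢0
  where
  a·u≡0′ : ∀ i → combination a u i ≡ 0ℚ
  a·u≡0′ zero    = sumFin-zero (λ j → trans (cong (a j *_) (head≡0 j)) (*-zeroʳ (a j)))
  a·u≡0′ (suc i) = a·u≡0 i

module PivotElimination {m n} (u : Fin (suc m) → Pt (suc n))
  (j₀ : Fin (suc m)) (pivot≢0 : u j₀ zero ≢ 0ℚ) where

  ratio : Fin m → ℚ
  ratio j = - (u (punchIn j₀ j) zero * inverse (u j₀ zero) pivot≢0)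

  reduced : Fin m → Pt (suc n)
  reduced j i = u (punchIn j₀ j) i + ratio j * u j₀ i

  reduced-head≡0 : ∀ j → reduced j zero ≡ 0ℚ
  reduced-head≡0 j = begin
    x + (- (x * ι)) * p
      ≡⟨ solve 3 (λ x ι p → x :+ (:- (x :* ι)) :* p := x :+ (:- (x :* (ι :* p)))) refl x ι p ⟩
    x + (- (x * (ι * p)))
      ≡⟨ cong (λ t → x + (- (x * t))) (inverse-*ˡ p pivot≢0) ⟩
    x + (- (x * 1ℚ))
      ≡⟨ solve 1 (λ x → x :+ (:- (x :* con 1ℚ)) := con 0ℚ) refl x ⟩
    0ℚ
      ∎
    where
    open ≡-Reasoning
    x p ι : ℚ
    x = u (punchIn j₀ j) zero
    p = u j₀ zero
    ι = inverse p pivot≢0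

  reduced-L : ∀ {J : Subset (suc n)} → (∀ j → L J (u j)) → ∀ j → L J (reduced j)
  reduced-L u∈L j i i∉J = begin
    u (punchIn j₀ j) i + ratio j * u j₀ i
      ≡⟨ cong₂ (λ x y → x + ratio j * y) (u∈L _ i i∉J) (u∈L j₀ i i∉J) ⟩
    0ℚ + ratio j * 0ℚ
      ≡⟨ solve 1 (λ r → con 0ℚ :+ r :* con 0ℚ := con 0ℚ) refl (ratio j) ⟩
    0ℚ
      ∎
    where open ≡-Reasoning

  combination-insertAt : ∀ (b : Fin m → ℚ) i →
    combination (insertAt b j₀ (sumFin (λ j → b j * ratio j))) u i ≡ combination b reduced i
  combination-insertAt b i = begin
    combination a u i
      ≡⟨ sumFin-remove (λ j → a j * u j i) j₀ ⟩
    a j₀ * u j₀ i + sumFin (λ j → a (punchIn j₀ j) * u (punchIn j₀ j) i)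
      ≡⟨ cong₂ _+_ (cong (_* u j₀ i) (insertAt-lookup b j₀ c))
                   (sumFin-cong (λ j → cong (_* u (punchIn j₀ j) i) (insertAt-punchIn b j₀ c j))) ⟩
    c * u j₀ i + sumFin (λ j → b j * u (punchIn j₀ j) i)
      ≡⟨ cong (_+ sumFin (λ j → b j * u (punchIn j₀ j) i)) (sumFin-*ʳ (u j₀ i) (λ j → b j * ratio j)) ⟨
    sumFin (λ j → b j * ratio j * u j₀ i) + sumFin (λ j → b j * u (punchIn j₀ j) i)
      ≡⟨ sumFin-+ (λ j → b j * ratio j * u j₀ i) (λ j → b j * u (punchIn j₀ j) i) ⟨
    sumFin (λ j → b j * ratio j * u j₀ i + b j * u (punchIn j₀ j) i)
      ≡⟨ sumFin-cong (λ j → solve 4 (λ b r y x → b :* r :* y :+ b :* x := b :* (x :+ r :* y))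
                                    refl (b j) (ratio j) (u j₀ i) (u (punchIn j₀ j) i)) ⟩
    combination b reduced i
      ∎
    where
    open ≡-Reasoning
    c : ℚ
    c = sumFin (λ j → b j * ratio j)
    a : Fin (suc m) → ℚ
    a = insertAt b j₀ c

  linDep-reduced⇒linDep : LinDep reduced → LinDep u
  linDep-reduced⇒linDep (b , b·w≡0 , j₁ , b≢0) =
    insertAt b j₀ c , (λ i → trans (combination-insertAt b i) (b·w≡0 i)) ,
    punchIn j₀ j₁ , (b≢0 ∘ trans (sym (insertAt-punchIn b j₀ c j₁)))
    where
    c : ℚ
    c = sumFin (λ j → b j * ratio j)

card<⇒linDep : ∀ {n m} (J : Subset n) (u : Fin m → Pt n) → card J ℕ.< m → (∀ j → L J (u j)) → LinDep u
card<⇒linDep {zero} {suc m} [] u _ _ = (λ _ → 1ℚ) , (λ ()) , zero , 1≢0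
card<⇒linDep {suc n} (outside ∷ J) u J<m u∈L =
  linDep-tail u (λ j → u∈L j zero λ ()) (card<⇒linDep J (Vector.tail ∘ u) J<m (L-tail ∘ u∈L))
card<⇒linDep {suc n} {suc m} (inside ∷ J) u (s≤s J<m) u∈L with any? (λ j → ¬? (u j zero ℚ.≟ 0ℚ))
... | no no-pivot = linDep-tail u head≡0
        (card<⇒linDep J (Vector.tail ∘ u) (ℕ.m≤n⇒m≤1+n J<m) (L-tail ∘ u∈L))
  where
  head≡0 : ∀ j → u j zero ≡ 0ℚ
  head≡0 j = decidable-stable (u j zero ℚ.≟ 0ℚ) (λ u≢0 → no-pivot (j , u≢0))
... | yes (j₀ , pivot≢0) = linDep-reduced⇒linDep (linDep-tail reduced reduced-head≡0
        (card<⇒linDep J (Vector.tail ∘ reduced) J<m (L-tail ∘ reduced-L u∈L)))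
  where open PivotElimination u j₀ pivot≢0

AffDep : ∀ {m n} → (Fin m → Pt n) → Set
AffDep {m} p = Σ (Fin m → ℚ) λ a → sumFin a ≡ 0ℚ × (∀ i → combination a p i ≡ 0ℚ) × Nontrivial a

affDep⇒¬affInd : ∀ {m n} {p : Fin m → Pt n} → AffDep p → ¬ AffInd p
affDep⇒¬affInd (a , Σa≡0 , a·p≡0 , j , aⱼ≢0) ind = aⱼ≢0 (ind a Σa≡0 a·p≡0 j)

AffineWeights : ∀ {m n} → (Fin m → Pt n) → Pt n → (Fin m → ℚ) → Set
AffineWeights p x μ = sumFin μ ≡ 1ℚ × (∀ i → x i ≡ combination μ p i)

InAffineHull : ∀ {m n} → (Fin m → Pt n) → Pt n → Set
InAffineHull p x = ∃ (AffineWeights p x)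

dot-combination : ∀ {m n} (w : Pt n) (a : Fin m → ℚ) (p : Fin m → Pt n) →
  dot w (combination a p) ≡ sumFin (λ j → a j * dot w (p j))
dot-combination w a p = begin
  sumFin (λ i → w i * sumFin (λ j → a j * p j i))
    ≡⟨ sumFin-cong (λ i → sumFin-*ˡ (w i) (λ j → a j * p j i)) ⟨
  sumFin (λ i → sumFin (λ j → w i * (a j * p j i)))
    ≡⟨ sumFin-comm (λ i j → w i * (a j * p j i)) ⟩
  sumFin (λ j → sumFin (λ i → w i * (a j * p j i)))
    ≡⟨ sumFin-cong (λ j → trans (sumFin-cong (λ i → reorder (w i) (a j) (p j i)))
                                (sumFin-*ˡ (a j) (λ i → w i * p j i))) ⟩
  sumFin (λ j → a j * dot w (p j))
    ∎
  where
  open ≡-Reasoning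
  reorder : ∀ w a x → w * (a * x) ≡ a * (w * x)
  reorder = solve 3 (λ w a x → w :* (a :* x) := a :* (w :* x)) refl

dot-combination-level : ∀ {m n} (w : Pt n) (c : ℚ) (a : Fin m → ℚ) (p : Fin m → Pt n) →
  (∀ j → dot w (p j) ≡ c) → dot w (combination a p) ≡ sumFin a * c
dot-combination-level w c a p level = begin
  dot w (combination a p)          ≡⟨ dot-combination w a p ⟩
  sumFin (λ j → a j * dot w (p j)) ≡⟨ sumFin-cong (λ j → cong (a j *_) (level j)) ⟩
  sumFin (λ j → a j * c)           ≡⟨ sumFin-*ʳ c a ⟩
  sumFin a * c                     ∎
  where open ≡-Reasoning

≡0⇒+≡0⇒≡0 : ∀ {a b} → a ≡ 0ℚ → a + b ≡ 0ℚ → b ≡ 0ℚ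
≡0⇒+≡0⇒≡0 {a} {b} a≡0 a+b≡0 = trans (sym (+-identityˡ b)) (trans (cong (_+ b) (sym a≡0)) a+b≡0)

linear-root : ∀ {a y s} (a≢0 : a ≢ 0ℚ) → a * y + s ≡ 0ℚ → y ≡ s * (- inverse a a≢0)
linear-root {a} {y} {s} a≢0 ay+s≡0 = sym (begin
  s * (- ι)
    ≡⟨ solve 4 (λ a y s ι → s :* (:- ι) := (a :* y :+ s) :* (:- ι) :+ (ι :* a) :* y) refl a y s ι ⟩
  (a * y + s) * (- ι) + ι * a * y
    ≡⟨ cong₂ (λ t u → t * (- ι) + u * y) ay+s≡0 (inverse-*ˡ a a≢0) ⟩
  0ℚ * (- ι) + 1ℚ * y
    ≡⟨ solve 2 (λ ι y → con 0ℚ :* (:- ι) :+ con 1ℚ :* y := y) refl ι y ⟩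
  y
    ∎)
  where
  open ≡-Reasoning
  ι : ℚ
  ι = inverse a a≢0

affInd∧affDep-∷⇒inAffineHull : ∀ {m n} {p : Fin m → Pt n} {x : Pt n} →
  AffInd p → AffDep (x Vector.∷ p) → InAffineHull p x
affInd∧affDep-∷⇒inAffineHull {m} {p = p} {x} ind (a , Σa≡0 , a·xp≡0 , j₁ , a≢0) with a zero ℚ.≟ 0ℚ
... | yes a₀≡0 = ⊥-elim (a≢0 (a≡0 j₁))
  where
  a≡0 : ∀ j → a j ≡ 0ℚ
  a≡0 zero    = a₀≡0
  a≡0 (suc j) = ind (Vector.tail a) (≡0⇒+≡0⇒≡0 a₀≡0 Σa≡0)
    (λ i → ≡0⇒+≡0⇒≡0 (trans (cong (_* x i) a₀≡0) (*-zeroˡ (x i))) (a·xp≡0 i)) j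
... | no a₀≢0 = μ , Σμ≡1 , x≡μ·p
  where
  κ : ℚ
  κ = - inverse (a zero) a₀≢0
  μ : Fin m → ℚ
  μ j = a (suc j) * κ
  Σμ≡1 : sumFin μ ≡ 1ℚ
  Σμ≡1 = begin
    sumFin (λ j → a (suc j) * κ)  ≡⟨ sumFin-*ʳ κ (Vector.tail a) ⟩
    sumFin (Vector.tail a) * κ    ≡⟨ linear-root a₀≢0 a₀*1+Σ≡0 ⟨
    1ℚ                            ∎
    where
    open ≡-Reasoning
    a₀*1+Σ≡0 : a zero * 1ℚ + sumFin (Vector.tail a) ≡ 0ℚ
    a₀*1+Σ≡0 = trans (cong (_+ sumFin (Vector.tail a)) (*-identityʳ (a zero))) Σa≡0
  x≡μ·p : ∀ i → x i ≡ combination μ p i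
  x≡μ·p i = begin
    x i
      ≡⟨ linear-root a₀≢0 (a·xp≡0 i) ⟩
    combination (Vector.tail a) p i * κ
      ≡⟨ sumFin-*ʳ κ (λ j → a (suc j) * p j i) ⟨
    sumFin (λ j → a (suc j) * p j i * κ)
      ≡⟨ sumFin-cong (λ j → solve 3 (λ a x k → a :* x :* k := a :* k :* x) refl (a (suc j)) (p j i) κ) ⟩
    combination μ p i
      ∎
    where open ≡-Reasoning

combination-assoc : ∀ {k m n} (a : Fin k → ℚ) (μ : Fin k → Fin m → ℚ) (v : Fin m → Pt n) i →
  combination a (λ l → combination (μ l) v) i ≡ combination (combination a μ) v i
combination-assoc a μ v i = begin
  sumFin (λ l → a l * sumFin (λ j → μ l j * v j i))
    ≡⟨ sumFin-cong (λ l → sumFin-*ˡ (a l) (λ j → μ l j * v j i)) ⟨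
  sumFin (λ l → sumFin (λ j → a l * (μ l j * v j i)))
    ≡⟨ sumFin-comm (λ l j → a l * (μ l j * v j i)) ⟩
  sumFin (λ j → sumFin (λ l → a l * (μ l j * v j i)))
    ≡⟨ sumFin-cong (λ j → trans (sumFin-cong (λ l → sym (*-assoc (a l) (μ l j) (v j i))))
                                (sumFin-*ʳ (v j i) (λ l → a l * μ l j))) ⟩
  sumFin (λ j → sumFin (λ l → a l * μ l j) * v j i)
    ∎
  where open ≡-Reasoning

sumFin-combination : ∀ {k m} (a : Fin k → ℚ) (μ : Fin k → Fin m → ℚ) →
  sumFin (combination a μ) ≡ sumFin (λ l → a l * sumFin (μ l))
sumFin-combination a μ = begin
  sumFin (λ j → sumFin (λ l → a l * μ l j)) ≡⟨ sumFin-comm (λ l j → a l * μ l j) ⟨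
  sumFin (λ l → sumFin (λ j → a l * μ l j)) ≡⟨ sumFin-cong (λ l → sumFin-*ˡ (a l) (μ l)) ⟩
  sumFin (λ l → a l * sumFin (μ l))         ∎
  where open ≡-Reasoning

affInd-in-affineSpan⇒card≤ : ∀ {M k n} (v : Fin M → Pt n) (V : Subset M) (p : Fin k → Pt n) →
  (∀ l → ∃[ μ ] L V μ × AffineWeights v (p l) μ) → AffInd p → k ℕ.≤ card V
affInd-in-affineSpan⇒card≤ {M} {k} v V p weighted ind =
  ℕ.≮⇒≥ (λ V<k → affDep⇒¬affInd (linDep⇒affDep (card<⇒linDep V μ V<k (λ l → proj₁ (proj₂ (weighted l))))) ind)
  where
  μ : Fin k → Pt M
  μ l = proj₁ (weighted l)
  Σμ≡1 : ∀ l → sumFin (μ l) ≡ 1ℚ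
  Σμ≡1 l = proj₁ (proj₂ (proj₂ (weighted l)))
  p≡μ·v : ∀ l i → p l i ≡ combination (μ l) v i
  p≡μ·v l = proj₂ (proj₂ (proj₂ (weighted l)))
  linDep⇒affDep : LinDep μ → AffDep p
  linDep⇒affDep (a , a·μ≡0 , nontrivial) = a , Σa≡0 , a·p≡0 , nontrivial
    where
    open ≡-Reasoning
    Σa≡0 : sumFin a ≡ 0ℚ
    Σa≡0 = begin
      sumFin a
        ≡⟨ sumFin-cong (λ l → trans (sym (*-identityʳ (a l))) (cong (a l *_) (sym (Σμ≡1 l)))) ⟩
      sumFin (λ l → a l * sumFin (μ l))
        ≡⟨ sumFin-combination a μ ⟨
      sumFin (combination a μ)
        ≡⟨ sumFin-zero a·μ≡0 ⟩
      0ℚ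
        ∎
    a·p≡0 : ∀ i → combination a p i ≡ 0ℚ
    a·p≡0 i = begin
      combination a p i
        ≡⟨ sumFin-cong (λ l → cong (a l *_) (p≡μ·v l i)) ⟩
      combination a (λ l → combination (μ l) v) i
        ≡⟨ combination-assoc a μ v i ⟩
      combination (combination a μ) v i
        ≡⟨ sumFin-zero (λ j → trans (cong (_* v j i) (a·μ≡0 j)) (*-zeroˡ (v j i))) ⟩
      0ℚ
        ∎

erase : ∀ {n} → Fin n → Pt n → Pt n
erase i₀ x i with i Fin.≟ i₀
... | yes _ = 0ℚ
... | no  _ = x i

erase-≢ : ∀ {n} {i₀ i : Fin n} (x : Pt n) → i ≢ i₀ → erase i₀ x i ≡ x i
erase-≢ {i₀ = i₀} {i} x i≢i₀ with i Fin.≟ i₀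
... | yes i≡i₀ = ⊥-elim (i≢i₀ i≡i₀)
... | no  _    = refl

erase-L : ∀ {n} {J : Subset n} {x : Pt n} (i₀ : Fin n) → L J x → L (J - i₀) (erase i₀ x)
erase-L i₀ x∈L i i∉J-i₀ with i Fin.≟ i₀
... | yes _    = refl
... | no i≢i₀ = x∈L i (λ i∈J → i∉J-i₀ (x∈p∧x≢y⇒x∈p-y i∈J i≢i₀))

-- A linear dependence of the vectors (1, p j with coordinate i₀ erased), which live on the #J coordinates
-- {0} ∪ (J - i₀), is an affine dependence of the p j away from i₀; at i₀ it is recovered from w, as w i₀ ≢ 0.
hyperplane-card<⇒affDep : ∀ {n m} (w : Pt n) (c : ℚ) {J : Subset n} {i₀ : Fin n} → i₀ ∈ J → w i₀ ≢ 0ℚ →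
  (p : Fin m → Pt n) → card J ℕ.< m → (∀ j → L J (p j)) → (∀ j → dot w (p j) ≡ c) → AffDep p
hyperplane-card<⇒affDep {n} {m} w c {J} {i₀} i₀∈J wᵢ₀≢0 p J<m p∈L p∈H =
  lift (card<⇒linDep _ lifted J-i₀<m lifted-L)
  where
  lifted : Fin m → Pt (suc n)
  lifted j = 1ℚ Vector.∷ erase i₀ (p j)
  lifted-L : ∀ j → L (inside ∷ (J - i₀)) (lifted j)
  lifted-L j zero    i∉ = ⊥-elim (i∉ here)
  lifted-L j (suc i) i∉ = erase-L i₀ (p∈L j) i (i∉ ∘ there)
  J-i₀<m : card (inside ∷ (J - i₀)) ℕ.< m
  J-i₀<m = ℕ.≤-<-trans (x∈p⇒∣p-x∣<∣p∣ i₀∈J) J<m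
  lift : LinDep lifted → AffDep p
  lift (a , a·lifted≡0 , nontrivial) = a , Σa≡0 , a·p≡0 , nontrivial
    where
    Σa≡0 : sumFin a ≡ 0ℚ
    Σa≡0 = trans (sumFin-cong (λ j → sym (*-identityʳ (a j)))) (a·lifted≡0 zero)
    off-i₀ : ∀ i → i ≢ i₀ → combination a p i ≡ 0ℚ
    off-i₀ i i≢i₀ = trans (sumFin-cong (λ j → cong (a j *_) (sym (erase-≢ (p j) i≢i₀)))) (a·lifted≡0 (suc i))
    at-i₀ : w i₀ * combination a p i₀ ≡ 0ℚ
    at-i₀ = begin
      w i₀ * combination a p i₀   ≡⟨ sumFin-single (λ i → w i * combination a p i) i₀
                                       (λ i i≢i₀ → trans (cong (w i *_) (off-i₀ i i≢i₀)) (*-zeroʳ (w i))) ⟨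
      dot w (combination a p)     ≡⟨ dot-combination-level w c a p p∈H ⟩
      sumFin a * c                ≡⟨ cong (_* c) Σa≡0 ⟩
      0ℚ * c                      ≡⟨ *-zeroˡ c ⟩
      0ℚ                          ∎
      where open ≡-Reasoning
    a·p≡0 : ∀ i → combination a p i ≡ 0ℚ
    a·p≡0 i with i Fin.≟ i₀
    ... | yes refl = *-cancelˡ-≡0 wᵢ₀≢0 at-i₀
    ... | no i≢i₀  = off-i₀ i i≢i₀

hasDim-intro : ∀ {n k d} {F : Region n} → k ≡ suc d → (p : Fin k → Pt n) → (∀ j → F (p j)) → AffInd p →
  ((q : Fin (suc (suc d)) → Pt n) → (∀ j → F (q j)) → ¬ AffInd q) → HasDim F d
hasDim-intro refl p p∈F ind maximal = (p , p∈F , ind) , maximal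

⊆0⇒dim≡0 : ∀ {n d} {F : Region n} → (∀ x → F x → ∀ i → x i ≡ 0ℚ) → HasDim F d → d ≡ 0
⊆0⇒dim≡0 {d = zero}  F⊆0 _ = refl
⊆0⇒dim≡0 {d = suc d} F⊆0 ((p , p∈F , ind) , _) = ⊥-elim (1≢0 (ind a Σa≡0 a·p≡0 zero))
  where
  a : Fin (suc (suc d)) → ℚ
  a zero          = 1ℚ
  a (suc zero)    = - 1ℚ
  a (suc (suc j)) = 0ℚ
  Σa≡0 : sumFin a ≡ 0ℚ
  Σa≡0 = cong (λ s → 1ℚ + (- 1ℚ + s)) (sumFin-zero {d} (λ _ → refl))
  a·p≡0 : ∀ i → combination a p i ≡ 0ℚ
  a·p≡0 i = sumFin-zero (λ j → trans (cong (a j *_) (F⊆0 (p j) (p∈F j) i)) (*-zeroʳ (a j)))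

-- Subsets of coordinates and of vertices

enum : ∀ {m} (V : Subset m) → Fin (card V) → Fin m
enum (inside  ∷ V) zero    = zero
enum (inside  ∷ V) (suc l) = suc (enum V l)
enum (outside ∷ V) l       = suc (enum V l)

enum-∈ : ∀ {m} (V : Subset m) l → enum V l ∈ V
enum-∈ (inside  ∷ V) zero    = here
enum-∈ (inside  ∷ V) (suc l) = there (enum-∈ V l)
enum-∈ (outside ∷ V) l       = there (enum-∈ V l)

extendByZero : ∀ {m} (V : Subset m) → (Fin (card V) → ℚ) → Fin m → ℚ
extendByZero (inside  ∷ V) a zero    = a zero
extendByZero (inside  ∷ V) a (suc j) = extendByZero V (Vector.tail a) j
extendByZero (outside ∷ V) a zero    = 0ℚ
extendByZero (outside ∷ V) a (suc j) = extendByZero V a j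

extendByZero-enum : ∀ {m} (V : Subset m) a l → extendByZero V a (enum V l) ≡ a l
extendByZero-enum (inside  ∷ V) a zero    = refl
extendByZero-enum (inside  ∷ V) a (suc l) = extendByZero-enum V (Vector.tail a) l
extendByZero-enum (outside ∷ V) a l       = extendByZero-enum V a l

combination-extendByZero : ∀ {m n} (V : Subset m) a (v : Fin m → Pt n) i →
  combination (extendByZero V a) v i ≡ combination a (v ∘ enum V) i
combination-extendByZero []            a v i = refl
combination-extendByZero (inside  ∷ V) a v i =
  cong (a zero * v zero i +_) (combination-extendByZero V (Vector.tail a) (v ∘ suc) i)
combination-extendByZero (outside ∷ V) a v i =
  trans (cong₂ _+_ (*-zeroˡ (v zero i)) (combination-extendByZero V a (v ∘ suc) i)) (+-identityˡ _)

affInd-∘enum : ∀ {m n} {v : Fin m → Pt n} (V : Subset m) → AffInd v → AffInd (v ∘ enum V)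
affInd-∘enum {v = v} V ind a Σa≡0 a·v≡0 l =
  trans (sym (extendByZero-enum V a l))
    (ind (extendByZero V a) Σa′≡0 (λ i → trans (combination-extendByZero V a v i) (a·v≡0 i)) (enum V l))
  where
  Σa′≡0 : sumFin (extendByZero V a) ≡ 0ℚ
  Σa′≡0 = begin
    sumFin (extendByZero V a)
      ≡⟨ sumFin-cong (λ j → *-identityʳ (extendByZero V a j)) ⟨
    combination {n = 1} (extendByZero V a) (λ _ _ → 1ℚ) zero
      ≡⟨ combination-extendByZero {n = 1} V a (λ _ _ → 1ℚ) zero ⟩
    sumFin (λ l → a l * 1ℚ)
      ≡⟨ sumFin-cong (λ l → *-identityʳ (a l)) ⟩
    sumFin a
      ≡⟨ Σa≡0 ⟩
    0ℚ
      ∎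
    where open ≡-Reasoning

card-∪+card-∩ : ∀ {m} (p q : Subset m) → card (p ∪ₛ q) ℕ.+ card (p ∩ₛ q) ≡ card p ℕ.+ card q
card-∪+card-∩ []            []            = refl
card-∪+card-∩ (inside  ∷ p) (inside  ∷ q) =
  cong suc (trans (ℕ.+-suc _ _) (trans (cong suc (card-∪+card-∩ p q)) (sym (ℕ.+-suc _ _))))
card-∪+card-∩ (inside  ∷ p) (outside ∷ q) = cong suc (card-∪+card-∩ p q)
card-∪+card-∩ (outside ∷ p) (inside  ∷ q) = trans (cong suc (card-∪+card-∩ p q)) (sym (ℕ.+-suc _ _))
card-∪+card-∩ (outside ∷ p) (outside ∷ q) = card-∪+card-∩ p q

+≡+-tight : ∀ {a b c d} → a ℕ.+ b ≡ c ℕ.+ d → a ℕ.≤ c → b ℕ.≤ d → a ≡ c × b ≡ d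
+≡+-tight {a} {b} {c} {d} a+b≡c+d a≤c b≤d =
  a≡c , ℕ.+-cancelˡ-≡ c b d (trans (cong (ℕ._+ b) (sym a≡c)) a+b≡c+d)
  where
  a≡c : a ≡ c
  a≡c with ℕ.m≤n⇒m<n∨m≡n a≤c
  ... | inj₁ a<c = ⊥-elim (ℕ.<-irrefl a+b≡c+d (ℕ.+-mono-<-≤ a<c b≤d))
  ... | inj₂ a≡c = a≡c

nonempty⇒card≡suc : ∀ {m} {p : Subset m} → Nonemptyₛ p → ∃[ d ] card p ≡ suc d
nonempty⇒card≡suc {p = p} (x , x∈p) =
  ℕ.pred (card p) , sym (ℕ.suc-pred (card p) {{ℕ.>-nonZero (ℕ.≤-<-trans z≤n (x∈p⇒∣p-x∣<∣p∣ x∈p))}})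

card≡suc⇒nonempty : ∀ {m d} (p : Subset m) → card p ≡ suc d → Nonemptyₛ p
card≡suc⇒nonempty {m} p p≡1+d with nonempty? p
... | yes p≢∅ = p≢∅
... | no  p≡∅ = ⊥-elim (ℕ.1+n≢0 (trans (sym p≡1+d) (trans (cong card (Empty-unique p≡∅)) (∣⊥∣≡0 m))))

select : ∀ {m} {P : Fin m → Set} → (∀ j → Dec (P j)) → Subset m
select {zero}  P? = []
select {suc m} P? = does (P? zero) ∷ select (P? ∘ suc)

select-sound : ∀ {m} {P : Fin m → Set} (P? : ∀ j → Dec (P j)) {j} → j ∈ select P? → P j
select-sound P? {zero} j∈ with P? zero
select-sound P? {zero} here | yes Pj = Pj
select-sound P? {suc j} (there j∈) = select-sound (P? ∘ suc) j∈

select-complete : ∀ {m} {P : Fin m → Set} (P? : ∀ j → Dec (P j)) {j} → P j → j ∈ select P?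
select-complete P? {zero} Pj with P? zero
... | yes _   = here
... | no  ¬Pj = ⊥-elim (¬Pj Pj)
select-complete P? {suc j} Pj = there (select-complete (P? ∘ suc) Pj)

Fin-singleton : ∀ {n} → 1 ≡ n → (i j : Fin n) → i ≡ j
Fin-singleton refl zero zero = refl

L-∩ : ∀ {n} {I I′ : Subset n} {x : Pt n} → L I x → L I′ x → L (I ∩ₛ I′) x
L-∩ {I = I} x∈L x∈L′ i i∉ with i ∈? I
... | yes i∈I = x∈L′ i (λ i∈I′ → i∉ (x∈p∩q⁺ (i∈I , i∈I′)))
... | no  i∉I = x∈L i i∉I

L-∪ˡ : ∀ {n} {I : Subset n} (I′ : Subset n) {x : Pt n} → L I x → L (I ∪ₛ I′) x
L-∪ˡ I′ x∈L i i∉ = x∈L i (i∉ ∘ x∈p∪q⁺ ∘ inj₁)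

L-∪ʳ : ∀ {n} (I : Subset n) {I′ : Subset n} {x : Pt n} → L I′ x → L (I ∪ₛ I′) x
L-∪ʳ I x∈L i i∉ = x∈L i (i∉ ∘ x∈p∪q⁺ ∘ inj₂)

L? : ∀ {n} (J : Subset n) (x : Pt n) → Dec (L J x)
L? J x = all? (λ i → ¬? (i ∈? J) →-dec (x i ℚ.≟ 0ℚ))

-- Faces

face-level : ∀ {n} {P F : Region n} ((w , c , _) : FaceOf P F) → ∀ {x} → F x → dot w x ≡ c
face-level (w , c , _ , F≐) {x} x∈F = proj₂ (proj₁ (F≐ x) x∈F)

face-affineClosed : ∀ {n m} {P F : Region n} → FaceOf P F → (q : Fin m → Pt n) → (∀ j → F (q j)) →
  ∀ {x} → P x → InAffineHull q x → F x
face-affineClosed F-face@(w , c , _ , F≐) q q∈F {x} x∈P (μ , Σμ≡1 , x≡μ·q) = proj₂ (F≐ x) (x∈P , level)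
  where
  open ≡-Reasoning
  level : dot w x ≡ c
  level = begin
    dot w x                  ≡⟨ sumFin-cong (λ i → cong (w i *_) (x≡μ·q i)) ⟩
    dot w (combination μ q)  ≡⟨ dot-combination-level w c μ q (face-level F-face ∘ q∈F) ⟩
    sumFin μ * c             ≡⟨ cong (_* c) Σμ≡1 ⟩
    1ℚ * c                   ≡⟨ *-identityˡ c ⟩
    c                        ∎

dot-+ : ∀ {n} (w w′ x : Pt n) → dot (λ i → w i + w′ i) x ≡ dot w x + dot w′ x
dot-+ w w′ x = trans (sumFin-cong (λ i → *-distribʳ-+ (x i) (w i) (w′ i)))
  (sumFin-+ (λ i → w i * x i) (λ i → w′ i * x i))

+≡+-tightˡ : ∀ {a b c d : ℚ} → c ≤ a → d ≤ b → a + b ≡ c + d → a ≡ c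
+≡+-tightˡ c≤a d≤b a+b≡c+d = ≤-antisym (≮⇒≥ (λ c<a → <-irrefl (sym a+b≡c+d) (+-mono-<-≤ c<a d≤b))) c≤a

-- The sum of two supporting functionals supports exactly the intersection.
face-∩ : ∀ {n} {P F F′ : Region n} → FaceOf P F → FaceOf P F′ → FaceOf P (F ∩ F′)
face-∩ {P = P} {F} {F′} (w , c , P≥c , F≐) (w′ , c′ , P≥c′ , F′≐) =
  (λ i → w i + w′ i) , c + c′ , P≥c+c′ , F∩F′≐
  where
  P≥c+c′ : ∀ x → P x → c + c′ ≤ dot (λ i → w i + w′ i) x
  P≥c+c′ x x∈P = subst (c + c′ ≤_) (sym (dot-+ w w′ x)) (+-mono-≤ (P≥c x x∈P) (P≥c′ x x∈P))
  F∩F′≐ : SameSet (F ∩ F′) (λ x → P x × dot (λ i → w i + w′ i) x ≡ c + c′)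
  F∩F′≐ x = to , from
    where
    to : (F ∩ F′) x → P x × dot (λ i → w i + w′ i) x ≡ c + c′
    to (x∈F , x∈F′) = proj₁ (proj₁ (F≐ x) x∈F) ,
      trans (dot-+ w w′ x) (cong₂ _+_ (proj₂ (proj₁ (F≐ x) x∈F)) (proj₂ (proj₁ (F′≐ x) x∈F′)))
    from : P x × dot (λ i → w i + w′ i) x ≡ c + c′ → (F ∩ F′) x
    from (x∈P , level) = proj₂ (F≐ x) (x∈P , wx≡c) , proj₂ (F′≐ x) (x∈P , w′x≡c′)
      where
      split : dot w x + dot w′ x ≡ c + c′
      split = trans (sym (dot-+ w w′ x)) level
      wx≡c : dot w x ≡ c
      wx≡c = +≡+-tightˡ (P≥c x x∈P) (P≥c′ x x∈P) split
      w′x≡c′ : dot w′ x ≡ c′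
      w′x≡c′ = +≡+-tightˡ (P≥c′ x x∈P) (P≥c x x∈P)
        (trans (+-comm (dot w′ x) (dot w x)) (trans split (+-comm c c′)))

face-resp-SameSet : ∀ {n} {P F G : Region n} → FaceOf P F → SameSet G F → FaceOf P G
face-resp-SameSet (w , c , P≥c , F≐) G≐F = w , c , P≥c ,
  λ x → (proj₁ (F≐ x) ∘ proj₁ (G≐F x)) , (proj₂ (G≐F x) ∘ proj₂ (F≐ x))

indicator∁ : ∀ {n} → Subset n → Pt n
indicator∁ J i with i ∈? J
... | yes _ = 0ℚ
... | no  _ = 1ℚ

face-L : ∀ {n} {P : Region n} → (∀ x → P x → ∀ i → 0ℚ ≤ x i) → (J : Subset n) → FaceOf P (P ∩ L J)
face-L {P = P} P≥0 J = indicator∁ J , 0ℚ , P≥0′ , P∩L≐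
  where
  term≥0 : ∀ {x} → P x → ∀ i → 0ℚ ≤ indicator∁ J i * x i
  term≥0 {x} x∈P i with i ∈? J
  ... | yes _ = ≤-reflexive (sym (*-zeroˡ (x i)))
  ... | no  _ = *-nonneg (nonNegative⁻¹ 1ℚ) (P≥0 _ x∈P i)
  P≥0′ : ∀ x → P x → 0ℚ ≤ dot (indicator∁ J) x
  P≥0′ x x∈P = sumFin-nonneg _ (term≥0 x∈P)
  term≡0 : ∀ {x} → L J x → ∀ i → indicator∁ J i * x i ≡ 0ℚ
  term≡0 {x} x∈L i with i ∈? J
  ... | yes _   = *-zeroˡ (x i)
  ... | no  i∉J = trans (cong (1ℚ *_) (x∈L i i∉J)) (*-zeroʳ 1ℚ)
  L-of-term≡0 : ∀ {x} → (∀ i → indicator∁ J i * x i ≡ 0ℚ) → L J x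
  L-of-term≡0 {x} terms≡0 i i∉J with i ∈? J | terms≡0 i
  ... | yes i∈J | _     = ⊥-elim (i∉J i∈J)
  ... | no  _   | t≡0   = trans (sym (*-identityˡ (x i))) t≡0
  P∩L≐ : SameSet (P ∩ L J) (λ x → P x × dot (indicator∁ J) x ≡ 0ℚ)
  P∩L≐ x = (λ (x∈P , x∈L) → x∈P , sumFin-zero (term≡0 x∈L)) ,
           (λ (x∈P , level) → x∈P , L-of-term≡0 (sumFin-nonneg≡0 _ (term≥0 x∈P) level))

-- Newton polyhedra and their compact faces

newton-nonneg : ∀ {n} (S : List (Fin n → ℕ)) {x} → Newton S x → ∀ i → 0ℚ ≤ x i
newton-nonneg S (r , p , p∈orthants , μ , μ≥0 , _ , x≡μ·p) i =
  subst (0ℚ ≤_) (sym (x≡μ·p i)) (sumFin-nonneg _ (λ j → *-nonneg (μ≥0 j) (pⱼ≥0 j)))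
  where
  pⱼ≥0 : ∀ j → 0ℚ ≤ p j i
  pⱼ≥0 j with p∈orthants j
  ... | k , _ , k≤pⱼ = ≤-trans (ℕ→ℚ-nonneg (k i)) (k≤pⱼ i)

shift : ∀ {n} → Fin n → ℚ → Pt n → Pt n
shift i t x k = x k + t * δ i k

shiftedOrthants-shift : ∀ {n} (S : List (Fin n → ℕ)) {y} i {t} → 0ℚ ≤ t →
  ShiftedOrthants S y → ShiftedOrthants S (shift i t y)
shiftedOrthants-shift S i t≥0 (k , k∈S , k≤y) =
  k , k∈S , λ l → subst (_≤ _) (+-identityʳ _) (+-mono-≤ (k≤y l) (*-nonneg t≥0 (δ-nonneg i l)))

combination-shift : ∀ {m n} (μ : Fin m → ℚ) (p : Fin m → Pt n) i t → sumFin μ ≡ 1ℚ →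
  ∀ k → shift i t (combination μ p) k ≡ combination μ (shift i t ∘ p) k
combination-shift μ p i t Σμ≡1 k = begin
  combination μ p k + t * δ i k
    ≡⟨ cong (combination μ p k +_) (*-identityˡ (t * δ i k)) ⟨
  combination μ p k + 1ℚ * (t * δ i k)
    ≡⟨ cong (λ s → combination μ p k + s * (t * δ i k)) Σμ≡1 ⟨
  combination μ p k + sumFin μ * (t * δ i k)
    ≡⟨ cong (combination μ p k +_) (sumFin-*ʳ (t * δ i k) μ) ⟨
  combination μ p k + sumFin (λ j → μ j * (t * δ i k))
    ≡⟨ sumFin-+ (λ j → μ j * p j k) (λ j → μ j * (t * δ i k)) ⟨
  sumFin (λ j → μ j * p j k + μ j * (t * δ i k))
    ≡⟨ sumFin-cong (λ j → *-distribˡ-+ (μ j) (p j k) (t * δ i k)) ⟨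
  combination μ (shift i t ∘ p) k
    ∎
  where open ≡-Reasoning

newton-shift : ∀ {n} (S : List (Fin n → ℕ)) {x} i {t} → 0ℚ ≤ t → Newton S x → Newton S (shift i t x)
newton-shift S i {t} t≥0 (r , p , p∈orthants , μ , μ≥0 , Σμ≡1 , x≡μ·p) =
  r , shift i t ∘ p , shiftedOrthants-shift S i t≥0 ∘ p∈orthants , μ , μ≥0 , Σμ≡1 ,
  λ k → trans (cong (_+ t * δ i k) (x≡μ·p k)) (combination-shift μ p i t Σμ≡1 k)

dot-shift : ∀ {n} (w x : Pt n) i t → dot w (shift i t x) ≡ dot w x + t * w i
dot-shift w x i t = begin
  sumFin (λ k → w k * (x k + t * δ i k))
    ≡⟨ sumFin-cong (λ k → *-distribˡ-+ (w k) (x k) (t * δ i k)) ⟩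
  sumFin (λ k → w k * x k + w k * (t * δ i k))
    ≡⟨ sumFin-+ (λ k → w k * x k) (λ k → w k * (t * δ i k)) ⟩
  dot w x + sumFin (λ k → w k * (t * δ i k))
    ≡⟨ cong (dot w x +_) (trans (sumFin-cong reorder) (sumFin-δ* i (λ k → t * w k))) ⟩
  dot w x + t * w i
    ∎
  where
  open ≡-Reasoning
  reorder : ∀ k → w k * (t * δ i k) ≡ δ i k * (t * w k)
  reorder k = solve 3 (λ w t d → w :* (t :* d) := d :* (t :* w)) refl (w k) t (δ i k)

module CompactFaceOfNewton {n} (S : List (Fin n → ℕ)) {τ : Region n} (w : Pt n) (c : ℚ)
  (supporting : ∀ x → Newton S x → c ≤ dot w x) (τ≐ : SameSet τ (λ x → Newton S x × dot w x ≡ c))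
  (B : ℚ) (bounded : ∀ x → τ x → ∀ i → ∣ x i ∣ ≤ B) where

  τ-face : FaceOf (Newton S) τ
  τ-face = w , c , supporting , τ≐

  τ⊆newton : Sub τ (Newton S)
  τ⊆newton x x∈τ = proj₁ (proj₁ (τ≐ x) x∈τ)

  τ-nonneg : ∀ x → τ x → ∀ i → 0ℚ ≤ x i
  τ-nonneg x = newton-nonneg S ∘ τ⊆newton x

  -- If w i were 0, τ would contain the whole ray x + t eᵢ (t ≥ 0).
  normal≢0 : ∀ {x} → τ x → ∀ i → w i ≢ 0ℚ
  normal≢0 {x} x∈τ i wᵢ≡0 = <-irrefl refl (<-≤-trans B<B+1 B+1≤B)
    where
    open ≤-Reasoning
    B≥0 : 0ℚ ≤ B
    B≥0 = ≤-trans (0≤∣p∣ (x i)) (bounded x x∈τ i)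
    t : ℚ
    t = B + 1ℚ
    y : Pt n
    y = shift i t x
    y∈newton : Newton S y
    y∈newton = newton-shift S i (+-mono-≤ B≥0 (nonNegative⁻¹ 1ℚ)) (τ⊆newton x x∈τ)
    y-level : dot w y ≡ c
    y-level = begin-equality
      dot w y            ≡⟨ dot-shift w x i t ⟩
      dot w x + t * w i  ≡⟨ cong (λ s → dot w x + t * s) wᵢ≡0 ⟩
      dot w x + t * 0ℚ   ≡⟨ cong (dot w x +_) (*-zeroʳ t) ⟩
      dot w x + 0ℚ       ≡⟨ +-identityʳ (dot w x) ⟩
      dot w x            ≡⟨ face-level τ-face x∈τ ⟩
      c                  ∎
    y∈τ : τ y
    y∈τ = proj₂ (τ≐ y) (y∈newton , y-level)
    B+1≤B : B + 1ℚ ≤ B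
    B+1≤B = begin
      B + 1ℚ                ≡⟨ +-identityˡ t ⟨
      0ℚ + t                ≤⟨ +-monoˡ-≤ t (τ-nonneg x x∈τ i) ⟩
      x i + t               ≡⟨ cong (x i +_) (*-identityʳ t) ⟨
      x i + t * 1ℚ          ≡⟨ cong (λ d → x i + t * d) (δ-diag i) ⟨
      x i + t * δ i i       ≡⟨ 0≤p⇒∣p∣≡p (τ-nonneg y y∈τ i) ⟨
      ∣ y i ∣               ≤⟨ bounded y y∈τ i ⟩
      B                     ∎
    B<B+1 : B < B + 1ℚ
    B<B+1 = subst (_< B + 1ℚ) (+-identityʳ B) (+-monoʳ-< B (positive⁻¹ 1ℚ))

  τ∋0⇒τ⊆0 : ∀ {x₀} → τ x₀ → (∀ i → x₀ i ≡ 0ℚ) → ∀ x → τ x → ∀ i → x i ≡ 0ℚ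
  τ∋0⇒τ⊆0 {x₀} x₀∈τ x₀≡0 x x∈τ i =
    *-cancelˡ-≡0 (normal≢0 x₀∈τ i)
      (sumFin-nonneg≡0 (λ k → w k * x k) (λ k → *-nonneg (w≥0 k) (τ-nonneg x x∈τ k)) wx≡0 i)
    where
    w·x₀≡0 : dot w x₀ ≡ 0ℚ
    w·x₀≡0 = sumFin-zero (λ k → trans (cong (w k *_) (x₀≡0 k)) (*-zeroʳ (w k)))
    c≡0 : c ≡ 0ℚ
    c≡0 = trans (sym (face-level τ-face x₀∈τ)) w·x₀≡0
    wx≡0 : dot w x ≡ 0ℚ
    wx≡0 = trans (face-level τ-face x∈τ) c≡0
    w≥0 : ∀ k → 0ℚ ≤ w k
    w≥0 k = subst₂ _≤_ c≡0 level (supporting _ (newton-shift S k (nonNegative⁻¹ 1ℚ) (τ⊆newton x₀ x₀∈τ)))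
      where
      level : dot w (shift k 1ℚ x₀) ≡ w k
      level = trans (dot-shift w x₀ k 1ℚ)
        (trans (cong (_+ 1ℚ * w k) w·x₀≡0) (trans (+-identityˡ (1ℚ * w k)) (*-identityˡ (w k))))

  section-affDep : ∀ {J m} → Nonemptyₛ J → (p : Fin m → Pt n) → card J ℕ.< m →
    (∀ j → (τ ∩ L J) (p j)) → AffDep p
  section-affDep {m = suc m} (i₀ , i₀∈J) p J<m p∈ =
    hyperplane-card<⇒affDep w c i₀∈J (normal≢0 (proj₁ (p∈ zero)) i₀) p J<m
      (proj₂ ∘ p∈) (face-level τ-face ∘ proj₁ ∘ p∈)

  section-affInd⇒≤card : ∀ {J k} → Nonemptyₛ J → (p : Fin k → Pt n) → AffInd p →
    (∀ j → (τ ∩ L J) (p j)) → k ℕ.≤ card J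
  section-affInd⇒≤card J≢∅ p ind p∈ = ℕ.≮⇒≥ (λ J<k → affDep⇒¬affInd (section-affDep J≢∅ p J<k p∈) ind)

  section-inAffineHull : ∀ {J m} → Nonemptyₛ J → (p : Fin m → Pt n) → AffInd p → card J ≡ m →
    (∀ j → (τ ∩ L J) (p j)) → ∀ {x} → (τ ∩ L J) x → InAffineHull p x
  section-inAffineHull J≢∅ p ind J≡m p∈ {x} x∈ =
    affInd∧affDep-∷⇒inAffineHull ind (section-affDep J≢∅ (x Vector.∷ p) (ℕ.≤-reflexive (cong suc J≡m)) xp∈)
    where
    xp∈ : ∀ j → (τ ∩ L _) ((x Vector.∷ p) j)
    xp∈ zero    = x∈
    xp∈ (suc j) = p∈ j

  section⊆face : ∀ {J m} {P H : Region n} → Sub τ P → FaceOf P H → Nonemptyₛ J →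
    (p : Fin m → Pt n) → AffInd p → card J ≡ m → (∀ j → H (p j)) → (∀ j → (τ ∩ L J) (p j)) →
    Sub (τ ∩ L J) H
  section⊆face τ⊆P H-face J≢∅ p ind J≡m p∈H p∈ x x∈ =
    face-affineClosed H-face p p∈H (τ⊆P x (proj₁ x∈)) (section-inAffineHull J≢∅ p ind J≡m p∈ x∈)

  compactFace-section : ∀ {J} → Nonempty (τ ∩ L J) → CompactFace (Newton S) (τ ∩ L J)
  compactFace-section {J} τ∩L≢∅ =
    face-resp-SameSet (face-∩ τ-face (face-L (λ _ → newton-nonneg S) J)) reassociate ,
    τ∩L≢∅ , B , λ x → bounded x ∘ proj₁
    where
    reassociate : SameSet (τ ∩ L J) (τ ∩ (Newton S ∩ L J))
    reassociate x = (λ (x∈τ , x∈L) → x∈τ , τ⊆newton x x∈τ , x∈L) , (λ (x∈τ , _ , x∈L) → x∈τ , x∈L)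

  compactFace-∩ : ∀ {σ σ′} → FaceOf (Newton S) σ → FaceOf (Newton S) σ′ → Sub σ τ →
    Nonempty (σ ∩ σ′) → CompactFace (Newton S) (σ ∩ σ′)
  compactFace-∩ σ-face σ′-face σ⊆τ σ∩σ′≢∅ =
    face-∩ σ-face σ′-face , σ∩σ′≢∅ , B , λ x → bounded x ∘ σ⊆τ x ∘ proj₁

  module Simplex {M : ℕ} (v : Fin M → Pt n) (v-affInd : AffInd v) (τ≐hull : SameSet τ (InConv v)) where

    vertex∈τ : ∀ j → τ (v j)
    vertex∈τ j = proj₂ (τ≐hull (v j)) (δ j , δ-nonneg j , sumFin-δ j , λ i → sym (sumFin-δ* j (λ k → v k i)))

    vertices : Subset n → Subset M
    vertices J = select (λ j → L? J (v j))

    vertices-L : ∀ {J j} → j ∈ vertices J → L J (v j)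
    vertices-L = select-sound _

    -- Coordinates are nonnegative, so one vanishing at x vanishes at every vertex of positive weight.
    hull-weights-L : ∀ {J x} ((μ , _) : InConv v x) → L J x → L (vertices J) μ
    hull-weights-L {J} {x} (μ , μ≥0 , _ , x≡μ·v) x∈L j j∉ with μ j ℚ.≟ 0ℚ
    ... | yes μⱼ≡0 = μⱼ≡0
    ... | no  μⱼ≢0 = ⊥-elim (j∉ (select-complete _ vⱼ∈L))
      where
      vⱼ∈L : L J (v j)
      vⱼ∈L i i∉J = *-cancelˡ-≡0 μⱼ≢0 (sumFin-nonneg≡0 (λ k → μ k * v k i)
        (λ k → *-nonneg (μ≥0 k) (τ-nonneg _ (vertex∈τ k) i)) (trans (sym (x≡μ·v i)) (x∈L i i∉J)) j)

    section-affInd⇒≤card-vertices : ∀ {J k} (p : Fin k → Pt n) → AffInd p →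
      (∀ l → (τ ∩ L J) (p l)) → k ℕ.≤ card (vertices J)
    section-affInd⇒≤card-vertices {J} p ind p∈ = affInd-in-affineSpan⇒card≤ v (vertices J) p weighted ind
      where
      weighted : ∀ l → ∃[ μ ] L (vertices J) μ × AffineWeights v (p l) μ
      weighted l with proj₁ (τ≐hull (p l)) (proj₁ (p∈ l))
      ... | hull@(μ , _ , Σμ≡1 , p≡μ·v) = μ , hull-weights-L hull (proj₂ (p∈ l)) , Σμ≡1 , p≡μ·v

    ≤card-of-vertices-in : ∀ {J} → Nonemptyₛ J → (V : Subset M) → (∀ j → j ∈ V → L J (v j)) →
      card V ℕ.≤ card J
    ≤card-of-vertices-in J≢∅ V V⊆L =
      section-affInd⇒≤card J≢∅ (v ∘ enum V) (affInd-∘enum V v-affInd) (λ l → vertex∈τ _ , V⊆L _ (enum-∈ V l))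

    vFace-intro : ∀ {F J} → CompactFace (Newton S) F → Nonemptyₛ J → Sub F (τ ∩ L J) →
      (V : Subset M) → card V ≡ card J → (∀ j → j ∈ V → F (v j)) → VFace (Newton S) F
    vFace-intro {F} {J} F-compact J≢∅ F⊆ V V≡J V⊆F = F-compact , d , F-dim , J , J≡1+d , λ x → proj₂ ∘ F⊆ x
      where
      d : ℕ
      d = proj₁ (nonempty⇒card≡suc {p = J} J≢∅)
      J≡1+d : card J ≡ suc d
      J≡1+d = proj₂ (nonempty⇒card≡suc {p = J} J≢∅)
      F-dim : HasDim F d
      F-dim = hasDim-intro {F = F} (trans V≡J J≡1+d) (v ∘ enum V) (λ l → V⊆F _ (enum-∈ V l))
        (affInd-∘enum V v-affInd)
        (λ q q∈F → affDep⇒¬affInd {p = q}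
          (section-affDep J≢∅ q (ℕ.≤-reflexive (cong suc J≡1+d)) (λ j → F⊆ _ (q∈F j))))

    record VFaceOfSimplex (σ : Region n) : Set₁ where
      field
        σ-face        : FaceOf (Newton S) σ
        I             : Subset n
        I≢∅           : Nonemptyₛ I
        σ⊆section     : Sub σ (τ ∩ L I)
        card-vertices : card (vertices I) ≡ card I
        vertices⊆σ    : ∀ j → j ∈ vertices I → σ (v j)

    -- σ has #I affinely independent points in τ ∩ L_I, which is affinely (#I−1)-dimensional; so σ = τ ∩ L_I.
    vFace⇒vFaceOfSimplex : ∀ {σ} → VFace (Newton S) σ → Sub σ τ → VFaceOfSimplex σ
    vFace⇒vFaceOfSimplex {σ} ((σ-face , _) , d , ((p , p∈σ , p-affInd) , _) , I , I≡1+d , σ⊆L) σ⊆τ = record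
      { σ-face        = σ-face
      ; I             = I
      ; I≢∅           = I≢∅
      ; σ⊆section     = σ⊆section
      ; card-vertices = ℕ.≤-antisym (≤card-of-vertices-in I≢∅ (vertices I) (λ _ → vertices-L))
                          (subst (ℕ._≤ card (vertices I)) (sym I≡1+d)
                                 (section-affInd⇒≤card-vertices p p-affInd p∈section))
      ; vertices⊆σ    = λ j j∈ → section⊆σ (v j) (vertex∈τ j , vertices-L j∈)
      }
      where
      I≢∅ = card≡suc⇒nonempty I I≡1+d
      σ⊆section : Sub σ (τ ∩ L I)
      σ⊆section x x∈σ = σ⊆τ x x∈σ , σ⊆L x x∈σ
      p∈section : ∀ j → (τ ∩ L I) (p j)
      p∈section j = σ⊆section (p j) (p∈σ j)
      section⊆σ : Sub (τ ∩ L I) σ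
      section⊆σ = section⊆face τ⊆newton σ-face I≢∅ p p-affInd I≡1+d p∈σ p∈section

    module TwoVFaces {d : ℕ} (1+d≡n : suc d ≡ n) (τ-dim : HasDim τ d) {σ σ′ : Region n}
      (D : VFaceOfSimplex σ) (D′ : VFaceOfSimplex σ′) {z : Pt n} (z∈σ : σ z) (z∈σ′ : σ′ z) where

      open VFaceOfSimplex D
      open VFaceOfSimplex D′ renaming (σ-face to σ′-face; I to I′; I≢∅ to I′≢∅; σ⊆section to σ′⊆section;
        card-vertices to card-vertices′; vertices⊆σ to vertices⊆σ′)

      σ∩σ′⊆section : Sub (σ ∩ σ′) (τ ∩ L (I ∩ₛ I′))
      σ∩σ′⊆section x (x∈σ , x∈σ′) =
        proj₁ (σ⊆section x x∈σ) , L-∩ (proj₂ (σ⊆section x x∈σ)) (proj₂ (σ′⊆section x x∈σ′))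

      -- If I ∩ I′ = ∅ then z = 0, which forces τ = {0}, hence n = 1 and I = I′.
      I∩I′≢∅ : Nonemptyₛ (I ∩ₛ I′)
      I∩I′≢∅ with nonempty? (I ∩ₛ I′) | I≢∅ | I′≢∅
      ... | yes I∩I′≢∅ | _ | _ = I∩I′≢∅
      ... | no  I∩I′≡∅ | i , i∈I | i′ , i′∈I′ =
        i , x∈p∩q⁺ (i∈I , subst (_∈ I′) (Fin-singleton 1≡n i′ i) i′∈I′)
        where
        z≡0 : ∀ k → z k ≡ 0ℚ
        z≡0 k = proj₂ (σ∩σ′⊆section z (z∈σ , z∈σ′)) k (λ k∈ → I∩I′≡∅ (k , k∈))
        1≡n : 1 ≡ n
        1≡n = trans (cong suc (sym (⊆0⇒dim≡0 (τ∋0⇒τ⊆0 (proj₁ (σ⊆section z z∈σ)) z≡0) τ-dim))) 1+d≡n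

      I∪I′≢∅ : Nonemptyₛ (I ∪ₛ I′)
      I∪I′≢∅ = proj₁ I≢∅ , x∈p∪q⁺ (inj₁ (proj₂ I≢∅))

      σ+σ′ : Region n
      σ+σ′ = τ ∩ L (I ∪ₛ I′)

      σ⊆σ+σ′ : Sub σ σ+σ′
      σ⊆σ+σ′ x x∈σ = proj₁ (σ⊆section x x∈σ) , L-∪ˡ I′ (proj₂ (σ⊆section x x∈σ))

      σ′⊆σ+σ′ : Sub σ′ σ+σ′
      σ′⊆σ+σ′ x x∈σ′ = proj₁ (σ′⊆section x x∈σ′) , L-∪ʳ I (proj₂ (σ′⊆section x x∈σ′))

      V V′ : Subset M
      V  = vertices I
      V′ = vertices I′

      V∩V′⊆σ∩σ′ : ∀ j → j ∈ V ∩ₛ V′ → (σ ∩ σ′) (v j)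
      V∩V′⊆σ∩σ′ j j∈ = vertices⊆σ j (proj₁ (x∈p∩q⁻ V V′ j∈)) , vertices⊆σ′ j (proj₂ (x∈p∩q⁻ V V′ j∈))

      V∪V′⊆ : ∀ {H : Region n} → Sub σ H → Sub σ′ H → ∀ j → j ∈ V ∪ₛ V′ → H (v j)
      V∪V′⊆ σ⊆H σ′⊆H j j∈ with x∈p∪q⁻ V V′ j∈
      ... | inj₁ j∈V  = σ⊆H (v j) (vertices⊆σ j j∈V)
      ... | inj₂ j∈V′ = σ′⊆H (v j) (vertices⊆σ′ j j∈V′)

      V∪V′⊆σ+σ′ : ∀ j → j ∈ V ∪ₛ V′ → σ+σ′ (v j)
      V∪V′⊆σ+σ′ = V∪V′⊆ σ⊆σ+σ′ σ′⊆σ+σ′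

      card-∪∧card-∩ : card (V ∪ₛ V′) ≡ card (I ∪ₛ I′) × card (V ∩ₛ V′) ≡ card (I ∩ₛ I′)
      card-∪∧card-∩ = +≡+-tight counting
        (≤card-of-vertices-in I∪I′≢∅ (V ∪ₛ V′) (λ j → proj₂ ∘ V∪V′⊆σ+σ′ j))
        (≤card-of-vertices-in I∩I′≢∅ (V ∩ₛ V′) (λ j → proj₂ ∘ σ∩σ′⊆section (v j) ∘ V∩V′⊆σ∩σ′ j))
        where
        counting : card (V ∪ₛ V′) ℕ.+ card (V ∩ₛ V′) ≡ card (I ∪ₛ I′) ℕ.+ card (I ∩ₛ I′)
        counting = trans (card-∪+card-∩ V V′)
          (trans (cong₂ ℕ._+_ card-vertices card-vertices′) (sym (card-∪+card-∩ I I′)))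

      card-∪ : card (V ∪ₛ V′) ≡ card (I ∪ₛ I′)
      card-∪ = proj₁ card-∪∧card-∩

      card-∩ : card (V ∩ₛ V′) ≡ card (I ∩ₛ I′)
      card-∩ = proj₂ card-∪∧card-∩

      ∩-vFace : VFace (Newton S) (σ ∩ σ′)
      ∩-vFace = vFace-intro (compactFace-∩ σ-face σ′-face (λ x → proj₁ ∘ σ⊆section x) (z , z∈σ , z∈σ′))
        I∩I′≢∅ σ∩σ′⊆section (V ∩ₛ V′) card-∩ V∩V′⊆σ∩σ′

      σ+σ′-smallest : SmallestFaceContaining τ σ σ′ σ+σ′
      σ+σ′-smallest = face-L τ-nonneg (I ∪ₛ I′) , σ⊆σ+σ′ , σ′⊆σ+σ′ ,
        λ H H-face σ⊆H σ′⊆H → section⊆face (λ _ x∈τ → x∈τ) H-face I∪I′≢∅ (v ∘ enum (V ∪ₛ V′))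
          (affInd-∘enum (V ∪ₛ V′) v-affInd) (sym card-∪) (λ l → V∪V′⊆ σ⊆H σ′⊆H _ (enum-∈ (V ∪ₛ V′) l))
          (λ l → V∪V′⊆σ+σ′ _ (enum-∈ (V ∪ₛ V′) l))

      σ+σ′-vFace : VFace (Newton S) σ+σ′
      σ+σ′-vFace = vFace-intro (compactFace-section (z , σ⊆σ+σ′ z z∈σ)) I∪I′≢∅
        (λ _ x∈ → x∈) (V ∪ₛ V′) card-∪ V∪V′⊆σ+σ′

mainTheorem7 : (n : ℕ) (S : List (Fin n → ℕ)) → S ≢ [] →
    (τ σ σ' : Region n) →
    SimplicialFacet (Newton S) τ →
    VFace (Newton S) σ → VFace (Newton S) σ' →
    Sub σ τ → Sub σ' τ →
    Nonempty (σ ∩ σ') →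
    VFace (Newton S) (σ ∩ σ')
      × Σ (Region n) (λ G → SmallestFaceContaining τ σ σ' G × VFace (Newton S) G)
mainTheorem7 n S _ τ σ σ′
  (((w , c , supporting , τ≐) , _ , B , bounded) , (d , 1+d≡n , τ-dim) , (_ , v , v-affInd , τ≐hull))
  σ-vFace σ′-vFace σ⊆τ σ′⊆τ (z , z∈σ , z∈σ′) = ∩-vFace , σ+σ′ , σ+σ′-smallest , σ+σ′-vFace
  where
  open CompactFaceOfNewton S w c supporting τ≐ B bounded
  open Simplex v v-affInd τ≐hull
  open TwoVFaces 1+d≡n τ-dim (vFace⇒vFaceOfSimplex σ-vFace σ⊆τ) (vFace⇒vFaceOfSimplex σ′-vFace σ′⊆τ) z∈σ z∈σ′
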